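{- Let $(\mathbb{F},\mathcal{R})$ be an STRS compatible with a cost-size interpretation, and let $s,t$ be terms of the same type, this type having order 1, such that $s$, $t$ and all their variables have type order $0$ or $1$. Let $\alpha,\zeta$ be valuations and assume $[\![s]\!]^{\mathsf{s}}_\alpha\sqsupseteq[\![t]\!]^{\mathsf{s}}_\alpha$. Then $[\![s]\!]^{\mathsf{c}}_{\alpha,\zeta}\ge[\![t]\!]^{\mathsf{c}}_{\alpha,\zeta}$ (pointwise) whenever $s\to_{\mathcal{R}}t$.
   Context: Types: base types $\mathbb{B}$; simple types $\sigma::=\iota\mid\sigma\Rightarrow\sigma$; order $\mathrm{ord}(\iota)=0$, $\mathrm{ord}(\sigma\Rightarrow\tau)=\max(1+\mathrm{ord}(\sigma),\mathrm{ord}(\tau))$. Each function symbol $\mathsf{f}$ has a type of order $\le2$, written $\mathsf{f}:(\vec\iota_1\Rightarrow\kappa_1)\Rightarrow\cdots\Rightarrow(\vec\iota_k\Rightarrow\kappa_k)\Rightarrow\nu_1\Rightarrow\cdots\Rightarrow\nu_l\Rightarrow\iota$ (all components base types). Terms are applicative terms over typed variables and function symbols. Rules $\ell\to r$ are pairs of terms of the same base type with $\ell=\mathsf{f}\,\ell_1\cdots\ell_m$ and $\mathrm{vars}(r)\subseteq\mathrm{vars}(\ell)$. Innermost rewriting: $\ell\gamma\to_{\mathcal{R}}r\gamma$ when no proper subterm of $\ell\gamma$ is an instance of a left-hand side, closed under both sides of application. Cost-size interpretation: quasi-ordered sets $(\mathcal{S}_\iota,\sqsupseteq_\iota)$ for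 base types; $\mathcal{S}_{\sigma\Rightarrow\tau}$ = order-preserving functions ordered pointwise. Cost sets: $\mathcal{C}_\kappa=\mathbb{N}$ for base $\kappa$; $\mathcal{C}_{\iota\Rightarrow\tau}=\mathcal{S}_\iota\Longrightarrow\mathcal{C}_\tau$ for base $\iota$; $\mathcal{C}_{\sigma\Rightarrow\tau}=\mathcal{C}_\sigma\Longrightarrow\mathcal{S}_\sigma\Longrightarrow\mathcal{C}_\tau$ when $\mathrm{ord}(\sigma)=1$ ($\Longrightarrow$: order-preserving functions; functions into $\mathbb{N}$ compared pointwise by $\ge$). Each $\mathsf{f}$ of type $\sigma$ gets $\mathcal{J}^{\mathsf{s}}_{\mathsf{f}}\in\mathcal{S}_\sigma$ and $\mathcal{J}^{\mathsf{c}}_{\mathsf{f}}\in\mathcal{C}_\sigma$. With valuations $\alpha$ (variables of type $\sigma$ to $\mathcal{S}_\sigma$) and $\zeta$ (to $\mathcal{C}_\sigma$): sizes $[\![x]\!]^{\mathsf{s}}_\alpha=\alpha(x)$, $[\![\mathsf{f}]\!]^{\mathsf{s}}_\alpha=\mathcal{J}^{\mathsf{s}}_{\mathsf{f}}$, $[\![s\,t]\!]^{\mathsf{s}}_\alpha=[\![s]\!]^{\mathsf{s}}_\alpha([\![t]\!]^{\mathsf{s}}_\alpha)$; costs (for terms whose type and variables' types have order $\le1$) $[\![x\,s_1\cdots s_n]\!]^{\mathsf{c}}_{\alpha,\zeta}=\zeta(x)([\![s_1]\!]^{\mathsf{s}}_\alpha,\dots,[\![s_n]\!]^{\mathsf{s}}_\alpha)$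 and $[\![\mathsf{f}\,s_1\cdots s_k\,t_1\cdots t_n]\!]^{\mathsf{c}}_{\alpha,\zeta}=\mathcal{J}^{\mathsf{c}}_{\mathsf{f}}([\![s_1]\!]^{\mathsf{c}},[\![s_1]\!]^{\mathsf{s}},\dots,[\![s_k]\!]^{\mathsf{c}},[\![s_k]\!]^{\mathsf{s}},[\![t_1]\!]^{\mathsf{s}},\dots,[\![t_n]\!]^{\mathsf{s}})$ with $s_1..s_k$ the order-1 arguments and $t_1..t_n$ ($n\le l$) base-type arguments (possibly a partial application). $\mathcal{C}(s)_{\alpha,\zeta}$ is the sum of $[\![t]\!]^{\mathsf{c}}_{\alpha,\zeta}$ over all non-variable base-type subterms $t$ of $s$. Compatibility: for every rule $\ell\to r$ and all $\alpha,\zeta$, $[\![\ell]\!]^{\mathsf{c}}_{\alpha,\zeta}>\mathcal{C}(r)_{\alpha,\zeta}$ and $[\![\ell]\!]^{\mathsf{s}}_\alpha\sqsupseteq[\![r]\!]^{\mathsf{s}}_\alpha$. -}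

module Defs where

open import Data.Nat using (ℕ; zero; suc; _+_; _≤_; _<_; _≥_; _>_; _⊔_)
open import Data.Nat.Properties using (≤-refl; ≤-trans)
open import Data.List using (List; []; _∷_; foldr)
open import Data.Product using (Σ; _×_; _,_; proj₁; proj₂; ∃)
open import Data.Empty using (⊥)
open import Data.Unit using (⊤)
open import Relation.Binary.PropositionalEquality using (_≡_; refl)
open import Relation.Nullary using (¬_)

data Ty (B : Set) : Set where
  base : B → Ty B
  _⇒_  : Ty B → Ty B → Ty B
infixr 5 _⇒_

ord : ∀ {B} → Ty B → ℕ
ord (base _) = 0
ord (σ ⇒ τ) = suc (ord σ) ⊔ ord τ

arr : ∀ {B} → List B → Ty B → Ty B
arr [] τ = τ
arr (ι ∷ ιs) τ = base ι ⇒ arr ιs τ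

-- Shape of the type of a function symbol:
--   (ι₁₁ ⇒ ι⃗₁ ⇒ κ₁) ⇒ ... ⇒ (ι_k1 ⇒ ι⃗_k ⇒ κ_k) ⇒ ν₁ ⇒ ... ⇒ ν_l ⇒ ι
-- Each functional argument has at least one argument, i.e. has order exactly 1.
record SymType (B : Set) : Set where
  field
    hoArgs   : List (B × List B × B)
    baseArgs : List B
    result   : B

hoTy : ∀ {B} → B × List B × B → Ty B
hoTy (ι , ιs , κ) = base ι ⇒ arr ιs (base κ)

symTy : ∀ {B} → SymType B → Ty B
symTy T = foldr (λ a τ → hoTy a ⇒ τ) (arr baseArgs (base result)) hoArgs
  where open SymType T

record Signature : Set₁ where
  field
    B     : Set
    F     : Set
    shape : F → SymType B

record QO : Set₁ where
  field
    Carrier : Set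
    _⊒_     : Carrier → Carrier → Set
    ⊒-refl  : ∀ x → x ⊒ x
    ⊒-trans : ∀ {x y z} → x ⊒ y → y ⊒ z → x ⊒ z

open QO public using (Carrier)

_⟹_ : QO → QO → QO
A ⟹ D = record
  { Carrier = Σ (A.Carrier → D.Carrier) (λ f → ∀ {x y} → x A.⊒ y → f x D.⊒ f y)
  ; _⊒_     = λ f g → ∀ x → proj₁ f x D.⊒ proj₁ g x
  ; ⊒-refl  = λ f x → D.⊒-refl (proj₁ f x)
  ; ⊒-trans = λ p q x → D.⊒-trans (p x) (q x)
  }
  where
  module A = QO A
  module D = QO D
infixr 4 _⟹_

_·_ : ∀ {A D : QO} → Carrier (A ⟹ D) → Carrier A → Carrier D
f · x = proj₁ f x
infixl 9 _·_

ℕ≥ : QO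
ℕ≥ = record
  { Carrier = ℕ ; _⊒_ = _≥_ ; ⊒-refl = λ _ → ≤-refl ; ⊒-trans = λ p q → ≤-trans q p }

module _ (Sig : Signature) where
  open Signature Sig

  data Tm : Ty B → Set where
    var : (σ : Ty B) → ℕ → Tm σ
    fun : (f : F) → Tm (symTy (shape f))
    app : ∀ {σ τ} → Tm (σ ⇒ τ) → Tm σ → Tm τ

  data Occ (ρ : Ty B) (x : ℕ) : ∀ {σ} → Tm σ → Set where
    here : Occ ρ x (var ρ x)
    inL  : ∀ {σ τ} {s : Tm (σ ⇒ τ)} {t : Tm σ} → Occ ρ x s → Occ ρ x (app s t)
    inR  : ∀ {σ τ} {s : Tm (σ ⇒ τ)} {t : Tm σ} → Occ ρ x t → Occ ρ x (app s t)

  data _⊴_ {τ} (u : Tm τ) : ∀ {σ} → Tm σ → Set where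
    ⊴-refl : u ⊴ u
    ⊴-appL : ∀ {σ ρ} {s : Tm (σ ⇒ ρ)} {t : Tm σ} → u ⊴ s → u ⊴ app s t
    ⊴-appR : ∀ {σ ρ} {s : Tm (σ ⇒ ρ)} {t : Tm σ} → u ⊴ t → u ⊴ app s t

  data _◁_ {τ} (u : Tm τ) : ∀ {σ} → Tm σ → Set where
    ◁-appL : ∀ {σ ρ} {s : Tm (σ ⇒ ρ)} {t : Tm σ} → u ⊴ s → u ◁ app s t
    ◁-appR : ∀ {σ ρ} {s : Tm (σ ⇒ ρ)} {t : Tm σ} → u ⊴ t → u ◁ app s t

  Subst : Set
  Subst = (σ : Ty B) → ℕ → Tm σ

  _[_] : ∀ {σ} → Tm σ → Subst → Tm σ
  var σ x [ γ ] = γ σ x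
  fun f   [ γ ] = fun f
  app s t [ γ ] = app (s [ γ ]) (t [ γ ])

  HeadFun : ∀ {σ} → Tm σ → Set
  HeadFun (var _ _) = ⊥
  HeadFun (fun _)   = ⊤
  HeadFun (app s _) = HeadFun s

  record Rule : Set where
    field
      ty      : B
      lhs     : Tm (base ty)
      rhs     : Tm (base ty)
      lhs-fun : HeadFun lhs
      vars-ok : ∀ ρ x → Occ ρ x rhs → Occ ρ x lhs

  record RuleSet : Set₁ where
    field
      Idx  : Set
      rule : Idx → Rule

  module _ (R : RuleSet) where
    open RuleSet R

    IsInstance : ∀ {σ} → Tm σ → Set
    IsInstance {σ} u = ∃ λ i → ∃ λ (γ : Subst) →
      _≡_ {A = Σ (Ty B) Tm} (base (Rule.ty (rule i)) , Rule.lhs (rule i) [ γ ]) (σ , u)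

    -- innermost rewrite step
    data Step : ∀ {σ} → Tm σ → Tm σ → Set where
      root : (i : Idx) (γ : Subst) →
             (∀ {τ} (u : Tm τ) → u ◁ (Rule.lhs (rule i) [ γ ]) → ¬ IsInstance u) →
             Step (Rule.lhs (rule i) [ γ ]) (Rule.rhs (rule i) [ γ ])
      ctxL : ∀ {σ τ} {s s' : Tm (σ ⇒ τ)} {t : Tm σ} → Step s s' → Step (app s t) (app s' t)
      ctxR : ∀ {σ τ} {s : Tm (σ ⇒ τ)} {t t' : Tm σ} → Step t t' → Step (app s t) (app s t')

  module _ (SB : B → QO) where

    S : Ty B → QO
    S (base ι) = SB ι
    S (σ ⇒ τ)  = S σ ⟹ S τ

    -- C σ (the definition for order-1 σ in the domain is also used, harmlessly,
    -- for higher-order domains; it is only relevant for types of order ≤ 2)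
    C : Ty B → QO
    C (base κ)          = ℕ≥
    C (base ι ⇒ τ)      = S (base ι) ⟹ C τ
    C ((σ₁ ⇒ σ₂) ⇒ τ)   = C (σ₁ ⇒ σ₂) ⟹ S (σ₁ ⇒ σ₂) ⟹ C τ

  record CSInterp : Set₁ where
    field
      SB : B → QO
      Js : (f : F) → Carrier (S SB (symTy (shape f)))
      Jc : (f : F) → Carrier (C SB (symTy (shape f)))

  module _ (I : CSInterp) where
    open CSInterp I

    SizeVal : Set
    SizeVal = (σ : Ty B) → ℕ → Carrier (S SB σ)

    CostVal : Set
    CostVal = (σ : Ty B) → ℕ → Carrier (C SB σ)

    SizeGe : (σ : Ty B) → Carrier (S SB σ) → Carrier (S SB σ) → Set
    SizeGe σ = QO._⊒_ (S SB σ)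

    CostGe : (σ : Ty B) → Carrier (C SB σ) → Carrier (C SB σ) → Set
    CostGe σ = QO._⊒_ (C SB σ)

    ⟦_⟧s : ∀ {σ} → Tm σ → SizeVal → Carrier (S SB σ)
    ⟦ var σ x ⟧s α = α σ x
    ⟦ fun f ⟧s   α = Js f
    ⟦ app {σ} {τ} s t ⟧s α = _·_ {S SB σ} {S SB τ} (⟦ s ⟧s α) (⟦ t ⟧s α)

    -- cost application: a base-type argument contributes its size, an
    -- order-1 argument its cost and its size (curried form of the paper's
    -- J^c_f(c₁,s₁,…,c_k,s_k,t₁,…,t_n) and ζ(x)(s₁,…,s_n))
    capp : (σ : Ty B) {τ : Ty B} → Carrier (C SB (σ ⇒ τ)) →
           Carrier (C SB σ) → Carrier (S SB σ) → Carrier (C SB τ)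
    capp (base ι)  {τ} f c v = _·_ {SB ι} {C SB τ} f v
    capp (σ₁ ⇒ σ₂) {τ} f c v =
      _·_ {S SB (σ₁ ⇒ σ₂)} {C SB τ}
        (_·_ {C SB (σ₁ ⇒ σ₂)} {S SB (σ₁ ⇒ σ₂) ⟹ C SB τ} f c) v

    ⟦_⟧c : ∀ {σ} → Tm σ → SizeVal → CostVal → Carrier (C SB σ)
    ⟦ var σ x ⟧c α ζ = ζ σ x
    ⟦ fun f ⟧c   α ζ = Jc f
    ⟦ app {σ} s t ⟧c α ζ = capp σ (⟦ s ⟧c α ζ) (⟦ t ⟧c α ζ) (⟦ t ⟧s α)

    baseCost : (σ : Ty B) → Carrier (C SB σ) → ℕ
    baseCost (base _) n = n
    baseCost (_ ⇒ _)  _ = 0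

    Csum : ∀ {σ} → Tm σ → SizeVal → CostVal → ℕ
    Csum (var _ _) α ζ = 0
    Csum {σ} (fun f) α ζ = baseCost σ (Jc f)
    Csum {σ} (app s t) α ζ = baseCost σ (⟦ app s t ⟧c α ζ) + Csum s α ζ + Csum t α ζ

    Compatible : RuleSet → Set
    Compatible R = ∀ i (α : SizeVal) (ζ : CostVal) →
        ⟦ Rule.lhs (rule i) ⟧c α ζ > Csum (Rule.rhs (rule i)) α ζ
        × SizeGe (base (Rule.ty (rule i))) (⟦ Rule.lhs (rule i) ⟧s α) (⟦ Rule.rhs (rule i) ⟧s α)
      where open RuleSet R

{-# OPTIONS --safe #-}
-- Rules have base type, so a step between terms of arrow type rewrites either
-- the function part or the argument of an application.  Compatibility makes
-- root steps decrease sizes, and substitution and monotonicity carry this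
-- through any context.  Costs are then compared by induction on the step, as
-- cost application is monotone in the cost function, in the size of a base-type
-- argument, and in the cost and size of an order-1 argument.
module Submission where

open import Defs
open import Data.Nat using (_≤_)
open import Data.Product using (proj₁; proj₂)
open import Relation.Binary.PropositionalEquality using (_≡_; refl; cong₂; subst₂; sym)

module _ {Sig : Signature} (I : CSInterp Sig) where
  open CSInterp I using (SB)

  capp-monoˡ-⊒ : ∀ σ {τ} {f g : Carrier (C Sig SB (σ ⇒ τ))} c v →
    CostGe Sig I (σ ⇒ τ) f g → CostGe Sig I τ (capp Sig I σ f c v) (capp Sig I σ g c v)
  capp-monoˡ-⊒ (base ι)  c v f⊒g = f⊒g v
  capp-monoˡ-⊒ (σ₁ ⇒ σ₂) c v f⊒g = f⊒g c v

  capp-monoʳ-⊒ : ∀ σ τ (f : Carrier (C Sig SB (σ ⇒ τ))) {c c' v v'} →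
    CostGe Sig I σ c c' → SizeGe Sig I σ v v' →
    CostGe Sig I τ (capp Sig I σ f c v) (capp Sig I σ f c' v')
  capp-monoʳ-⊒ (base ι)  τ f c⊒c' v⊒v' = proj₂ f v⊒v'
  capp-monoʳ-⊒ (σ₁ ⇒ σ₂) τ f {c} {v' = v'} c⊒c' v⊒v' =
    QO.⊒-trans (C Sig SB τ) (proj₂ (proj₁ f c) v⊒v') (proj₂ f c⊒c' v')

  ⟦⟧s-subst : ∀ {σ} (l : Tm Sig σ) (γ : Subst Sig) (α : SizeVal Sig I) →
    ⟦_⟧s Sig I (_[_] Sig l γ) α ≡ ⟦_⟧s Sig I l (λ ρ x → ⟦_⟧s Sig I (γ ρ x) α)
  ⟦⟧s-subst (var σ x) γ α = refl
  ⟦⟧s-subst (fun f)   γ α = refl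
  ⟦⟧s-subst (app s t) γ α = cong₂ proj₁ (⟦⟧s-subst s γ α) (⟦⟧s-subst t γ α)

  module _ {R : RuleSet Sig} (compat : Compatible Sig I R) where
    open RuleSet R

    -- Compatibility bounds sizes only jointly with costs, hence the cost valuation ζ.
    step-⊒s : ∀ {σ} {s t : Tm Sig σ} (α : SizeVal Sig I) (ζ : CostVal Sig I) →
      Step Sig R s t → SizeGe Sig I σ (⟦_⟧s Sig I s α) (⟦_⟧s Sig I t α)
    step-⊒s α ζ (root i γ _) =
      subst₂ (SizeGe Sig I (base (Rule.ty (rule i))))
        (sym (⟦⟧s-subst (Rule.lhs (rule i)) γ α)) (sym (⟦⟧s-subst (Rule.rhs (rule i)) γ α))
        (proj₂ (compat i (λ ρ x → ⟦_⟧s Sig I (γ ρ x) α) ζ))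
    step-⊒s α ζ (ctxL {t = u} s→s')  = step-⊒s α ζ s→s' (⟦_⟧s Sig I u α)
    step-⊒s α ζ (ctxR {s = f} t→t') = proj₂ (⟦_⟧s Sig I f α) (step-⊒s α ζ t→t')

    step-⊒c : ∀ {σ τ} {s t : Tm Sig (σ ⇒ τ)} (α : SizeVal Sig I) (ζ : CostVal Sig I) →
      Step Sig R s t → CostGe Sig I (σ ⇒ τ) (⟦_⟧c Sig I s α ζ) (⟦_⟧c Sig I t α ζ)
    step-⊒c α ζ (ctxL {σ = ρ} {t = u} s→s') =
      capp-monoˡ-⊒ ρ (⟦_⟧c Sig I u α ζ) (⟦_⟧s Sig I u α) (step-⊒c α ζ s→s')
    -- a base-type argument contributes only its size, so its cost may grow
    step-⊒c {σ} {τ} α ζ (ctxR {σ = base ι} {s = f} {t = u} t→t') =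
      capp-monoʳ-⊒ (base ι) (σ ⇒ τ) (⟦_⟧c Sig I f α ζ)
        (QO.⊒-refl (C Sig SB (base ι)) (⟦_⟧c Sig I u α ζ)) (step-⊒s α ζ t→t')
    step-⊒c {σ} {τ} α ζ (ctxR {σ = σ₁ ⇒ σ₂} {s = f} t→t') =
      capp-monoʳ-⊒ (σ₁ ⇒ σ₂) (σ ⇒ τ) (⟦_⟧c Sig I f α ζ) (step-⊒c α ζ t→t') (step-⊒s α ζ t→t')

lemma3p6 : (Sig : Signature) (R : RuleSet Sig) (I : CSInterp Sig) →
    Compatible Sig I R →
    {σ : Ty (Signature.B Sig)} (s t : Tm Sig σ) →
    ord σ ≡ 1 →
    (∀ ρ x → Occ Sig ρ x s → ord ρ ≤ 1) →
    (∀ ρ x → Occ Sig ρ x t → ord ρ ≤ 1) →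
    (α : SizeVal Sig I) (ζ : CostVal Sig I) →
    SizeGe Sig I σ (⟦_⟧s Sig I s α) (⟦_⟧s Sig I t α) →
    Step Sig R s t →
    CostGe Sig I σ (⟦_⟧c Sig I s α ζ) (⟦_⟧c Sig I t α ζ)
lemma3p6 Sig R I compat {base ι} s t ()
lemma3p6 Sig R I compat {σ ⇒ τ} s t _ _ _ α ζ _ s→t = step-⊒c I compat α ζ s→t
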